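{- $Sh(\omega+1)+Sh(\omega)\leq_5 Sh(\omega+1)$.
   Context: $Sh(\omega)$ is the shuffle sum of all finite orders of positive size and $Sh(\omega+1)$ the shuffle sum of all finite orders of positive size together with $\omega$; the shuffle sum of a countable set $S$ of order types is obtained from the countable dense colored linear ordering without endpoints with colors in bijection with $S$, each color dense, by replacing each point of color $c$ with a copy of the corresponding order type. The standard asymmetric back-and-forth relations on pairs (structure, tuple) are: $(\mathcal M,\bar a)\leq_0(\mathcal N,\bar b)$ if $\bar a$ and $\bar b$ satisfy the same quantifier-free formulas among the first $|\bar a|$ formulas in a fixed enumeration; for $\alpha>0$, $(\mathcal M,\bar a)\leq_\alpha(\mathcal N,\bar b)$ if for every $\beta<\alpha$ and every tuple $\bar d$ in $\mathcal N$ there is a tuple $\bar c$ in $\mathcal M$ with $(\mathcal N,\bar b\bar d)\leq_\beta(\mathcal M,\bar a\bar c)$. $\mathcal M\leq_\alpha\mathcal N$ means this holds with empty tuples. Here the structures are linear orderings in the language $\{<\}$. -}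

module Defs where

open import Data.Nat using (ℕ; suc) renaming (_<_ to _<ℕ_)
open import Data.Fin using (Fin) renaming (_<_ to _<F_)
open import Data.Maybe using (Maybe; just; nothing)
open import Data.Sum using (_⊎_; inj₁; inj₂)
open import Data.Product using (Σ; ∃; _×_; _,_)
open import Data.Vec.Functional using (_++_)
open import Relation.Binary.PropositionalEquality using (_≡_)
open import Relation.Binary.Structures using (IsStrictTotalOrder)
open import Function.Bundles using (_⇔_)

record LO : Set₁ where
  field
    Carrier : Set
    _≺_     : Carrier → Carrier → Set
open LO public

-- A countable dense linear ordering without endpoints, coloured by C,
-- in which every colour is dense.  (Countable and nonempty: enumerated
-- by a surjection from ℕ.)

record ColoredDense (C : Set) : Set₁ where
  field
    Pt        : Set
    _<_       : Pt → Pt → Set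
    isSTO     : IsStrictTotalOrder _≡_ _<_
    enum      : ℕ → Pt
    enum-surj : ∀ x → ∃ λ n → enum n ≡ x
    noMin     : ∀ x → ∃ λ y → y < x
    noMax     : ∀ x → ∃ λ y → x < y
    color     : Pt → C
    colorDense : ∀ x y (c : C) → x < y → ∃ λ z → (x < z) × (z < y) × (color z ≡ c)

module _ {C : Set} (D : ColoredDense C) (F : C → LO) where
  open ColoredDense D

  ShCarrier : Set
  ShCarrier = Σ Pt (λ x → Carrier (F (color x)))

  data ShLt : ShCarrier → ShCarrier → Set where
    outer : ∀ {x y i j} → x < y → ShLt (x , i) (y , j)
    inner : ∀ {x i j} → _≺_ (F (color x)) i j → ShLt (x , i) (x , j)

shuffle : {C : Set} → ColoredDense C → (C → LO) → LO
shuffle D F = record { Carrier = ShCarrier D F ; _≺_ = ShLt D F }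

finLO : ℕ → LO
finLO k = record { Carrier = Fin (suc k) ; _≺_ = _<F_ }

ωLO : LO
ωLO = record { Carrier = ℕ ; _≺_ = _<ℕ_ }

-- colours for Sh(ω): k ↦ finite order of size k+1 (all positive sizes)
colSh0 : ℕ → LO
colSh0 = finLO

-- colours for Sh(ω+1): nothing ↦ ω, just k ↦ finite order of size k+1
colSh1 : Maybe ℕ → LO
colSh1 nothing  = ωLO
colSh1 (just k) = finLO k

Shω : ColoredDense ℕ → LO
Shω D = shuffle D colSh0

Shω+1 : ColoredDense (Maybe ℕ) → LO
Shω+1 D = shuffle D colSh1

data SumLt (M N : LO) : Carrier M ⊎ Carrier N → Carrier M ⊎ Carrier N → Set where
  ll : ∀ {a b} → _≺_ M a b → SumLt M N (inj₁ a) (inj₁ b)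
  rr : ∀ {a b} → _≺_ N a b → SumLt M N (inj₂ a) (inj₂ b)
  lr : ∀ {a b} → SumLt M N (inj₁ a) (inj₂ b)

_⊕_ : LO → LO → LO
M ⊕ N = record { Carrier = Carrier M ⊎ Carrier N ; _≺_ = SumLt M N }

-- Standard asymmetric back-and-forth relations, finite levels.
-- Level 0: the tuples satisfy the same atomic (hence quantifier-free)
-- formulas  x_i < x_j,  x_i = x_j.

SameAtomic : (M : LO) {n : ℕ} → (Fin n → Carrier M) → (N : LO) → (Fin n → Carrier N) → Set
SameAtomic M {n} a N b =
  ∀ (i j : Fin n) → (_≺_ M (a i) (a j) ⇔ _≺_ N (b i) (b j)) × ((a i ≡ a j) ⇔ (b i ≡ b j))

mutual
  BF : ℕ → (M : LO) {n : ℕ} → (Fin n → Carrier M) → (N : LO) → (Fin n → Carrier N) → Set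
  BF 0       M a N b = SameAtomic M a N b
  BF (suc α) M a N b = Below α M a N b

  -- Below α M a N b : for every β ≤ α (i.e. β < α+1) and every tuple d in N
  -- there is c in M with (N , b d) ≤_β (M , a c).
  Below : ℕ → (M : LO) {n : ℕ} → (Fin n → Carrier M) → (N : LO) → (Fin n → Carrier N) → Set
  Below 0       M a N b = Step 0 M a N b
  Below (suc β) M a N b = Step (suc β) M a N b × Below β M a N b

  Step : ℕ → (M : LO) {n : ℕ} → (Fin n → Carrier M) → (N : LO) → (Fin n → Carrier N) → Set
  Step β M {n} a N b =
    ∀ (m : ℕ) (d : Fin m → Carrier N) → ∃ λ (c : Fin m → Carrier M) → BF β N (b ++ d) M (a ++ c)

_≤[_]_ : LO → ℕ → LO → Set
M ≤[ α ] N = BF α M {0} (λ ()) N (λ ())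

-- Both orders are lexicographic sums, over a dense order of blocks, of copies of ω and of finite
-- orders, so a point is a block together with an offset in it. Tuples chosen in the game are kept
-- matched offset for offset through an order isomorphism between the blocks they meet, while the
-- required relation between the sizes of matched blocks weakens as the level drops: at level 5 the
-- sum answers inside its Sh(ω+1) summand and at level 4 Sh(ω+1) answers, both with equal sizes; at
-- level 3 an ω-block is answered by a finite block longer than every offset being challenged; at
-- level 2 Sh(ω+1) answers with a block at least as large. At level 1 the sum answers so that no
-- distance inside a block shrinks, which is all the atomic type at level 0 needs. Fresh blocks of
-- the required size exist between any blocks already used because every colour is dense.

module Submission where

open import Defs
open import Data.Empty using (⊥; ⊥-elim)
open import Data.Fin using (Fin; zero; suc; splitAt; _↑ˡ_; _↑ʳ_; toℕ; fromℕ<)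
open import Data.Fin.Properties using (any?; toℕ-fromℕ<; toℕ-injective; toℕ<n)
open import Data.Maybe using (Maybe; just; nothing)
open import Data.Nat using (ℕ; zero; suc; _+_; _∸_; _≤_; _<_; z≤n; s≤s)
open import Data.Nat.Tactic.RingSolver using (solve-∀)
import Data.Nat.Properties as ℕ
open import Data.Product using (Σ; ∃-syntax; _×_; _,_; proj₁; proj₂)
import Data.Product as Product
open import Data.Sum using (_⊎_; inj₁; inj₂; [_,_]′)
import Data.Sum as Sum
open import Data.Sum.Properties using (inj₁-injective; inj₂-injective)
open import Data.Sum.Relation.Binary.LeftOrder
  using (_⊎-<_; ₁∼₂; ₁∼₁; ₂∼₂; drop-inj₁; ⊎-<-transitive; ⊎-<-isStrictTotalOrder)
open import Data.Sum.Relation.Binary.Pointwise using (Pointwise-≡⇒≡; ≡⇒Pointwise-≡)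
open import Data.Unit using (⊤; tt)
open import Data.Vec.Functional using (_++_; _∷_; [])
open import Data.Vec.Functional.Properties using (lookup-++ˡ; lookup-++ʳ)
open import Function using (_∘_; flip; id)
open import Function.Bundles using (_⇔_; mk⇔; Equivalence)
import Function.Properties.Equivalence as ⇔
open import Relation.Binary.PropositionalEquality hiding ([_])
open import Relation.Nullary using (¬_; Dec; yes; no; ¬?)
open import Relation.Nullary.Construct.Add.Extrema using (_±; ⊥±; ⊤±; [_])
import Relation.Binary.Construct.Add.Extrema.Strict as Strict±
import Relation.Binary.Construct.Flip.EqAndOrd as Flip
open import Relation.Binary.Definitions using (Tri; tri<; tri≈; tri>)
open import Relation.Binary.Structures using (IsStrictTotalOrder)
open import Relation.Binary.Structures.Biased using (isStrictTotalOrderᶜ)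

-- Tuples

module _ {A B : Set} where

  Pairwise : (A → B → A → B → Set) → ∀ {n} → (Fin n → A) → (Fin n → B) → Set
  Pairwise Q x y = ∀ i j → Q (x i) (y i) (x j) (y j)

  Pairwise-∷ : ∀ {Q n} {x : Fin n → A} {y : Fin n → B} {a b} → Pairwise Q x y →
               Q a b a b → (∀ i → Q a b (x i) (y i) × Q (x i) (y i) a b) →
               Pairwise Q (a ∷ x) (b ∷ y)
  Pairwise-∷ q _  _ (suc i) (suc j) = q i j
  Pairwise-∷ _ qq _ zero    zero    = qq
  Pairwise-∷ _ _  q zero    (suc j) = proj₁ (q j)
  Pairwise-∷ _ _  q (suc i) zero    = proj₂ (q i)

  Reindexable : (∀ {n} → (Fin n → A) → (Fin n → B) → Set) → Set
  Reindexable Inv = ∀ {m n} {x : Fin n → A} {y : Fin n → B} {x′ : Fin m → A} {y′ : Fin m → B}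
    (ρ : Fin m → Fin n) → x′ ≗ x ∘ ρ → y′ ≗ y ∘ ρ → Inv x y → Inv x′ y′

  Pairwise-reindex : ∀ {Q} → Reindexable (Pairwise Q)
  Pairwise-reindex {Q} {x = x} {y} {x′} {y′} ρ x′≗ y′≗ q i j =
    subst₂ (λ a b → Q a b (x′ j) (y′ j)) (sym (x′≗ i)) (sym (y′≗ i))
      (subst₂ (Q (x (ρ i)) (y (ρ i))) (sym (x′≗ j)) (sym (y′≗ j)) (q (ρ i) (ρ j)))

dropEmpty : ∀ n → Fin (n + 0) → Fin n
dropEmpty n i = [ id , (λ ()) ]′ (splitAt n i)

moveHead : ∀ n m → Fin (n + suc m) → Fin (suc n + m)
moveHead n m i = [ (λ j → suc (j ↑ˡ m)) , (λ { zero → zero ; (suc k) → suc (n ↑ʳ k) }) ]′ (splitAt n i)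

module _ {A : Set} where

  ++-empty : ∀ {n} (x : Fin n → A) (c : Fin 0 → A) → x ++ c ≗ x ∘ dropEmpty n
  ++-empty {n} x c i with splitAt n i
  ... | inj₁ j = refl

  ++-∷-moveHead : ∀ {n m} (x : Fin n → A) (a : Fin (suc m) → A) →
                  x ++ a ≗ ((a zero ∷ x) ++ (a ∘ suc)) ∘ moveHead n m
  ++-∷-moveHead {n} {m} x a i with splitAt n i
  ... | inj₁ j       = sym (lookup-++ˡ (a zero ∷ x) (a ∘ suc) (suc j))
  ... | inj₂ zero    = refl
  ... | inj₂ (suc k) = sym (lookup-++ʳ (a zero ∷ x) (a ∘ suc) k)

module _ {A B : Set} (Inv : ∀ {n} → (Fin n → A) → (Fin n → B) → Set) (reindex : Reindexable Inv)
         (Ok : B → Set)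
         (extend₁ : ∀ {n} {x : Fin n → A} {y : Fin n → B} → Inv x y → ∀ b → Ok b → Σ A λ a → Inv (a ∷ x) (b ∷ y))
         where

  extendAll : ∀ m {n} {x : Fin n → A} {y : Fin n → B} → Inv x y → (d : Fin m → B) → (∀ k → Ok (d k)) →
              Σ (Fin m → A) λ c → Inv (x ++ c) (y ++ d)
  extendAll zero    {n} {x} {y} inv d _ =
    (λ ()) , reindex {x = x} {y = y} (dropEmpty n) (++-empty x _) (++-empty y d) inv
  extendAll (suc m) {n} {x} {y} inv d ok with extend₁ inv (d zero) (ok zero)
  ... | a , inv₁ with extendAll m inv₁ (d ∘ suc) (ok ∘ suc)
  ...   | c , inv₂ = (a ∷ c) , reindex {x = (a ∷ x) ++ c} {y = (d zero ∷ y) ++ (d ∘ suc)} (moveHead n m)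
                                 (++-∷-moveHead x (a ∷ c)) (++-∷-moveHead y d) inv₂

-- Back-and-forth relations

AtomicAgree : (M N : LO) → Carrier M → Carrier N → Carrier M → Carrier N → Set
AtomicAgree M N p q p′ q′ = (_≺_ M p p′ ⇔ _≺_ N q q′) × (p ≡ p′ ⇔ q ≡ q′)

module _ {M N : LO} where

  AtomicAgree-sym : ∀ {p q p′ q′} → AtomicAgree M N p q p′ q′ → AtomicAgree N M q p q′ p′
  AtomicAgree-sym (≺⇔ , ≡⇔) = ⇔.sym ≺⇔ , ⇔.sym ≡⇔

  SameAtomic-sym : ∀ {n} {a : Fin n → Carrier M} {b : Fin n → Carrier N} →
                   SameAtomic M a N b → SameAtomic N b M a
  SameAtomic-sym agree i j = AtomicAgree-sym (agree i j)

  AtomicAgree-< : (∀ {p p′} → _≺_ M p p′ → ¬ _≺_ M p′ p) → (∀ {q q′} → _≺_ N q q′ → ¬ _≺_ N q′ q) →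
                  ∀ {p q p′ q′} → _≺_ M p p′ → _≺_ N q q′ →
                  AtomicAgree M N p q p′ q′ × AtomicAgree M N p′ q′ p q
  AtomicAgree-< asymM asymN p<p′ q<q′ =
      (mk⇔ (λ _ → q<q′) (λ _ → p<p′) , mk⇔ (λ p≡p′ → ⊥-elim (irrM p≡p′ p<p′)) (λ q≡q′ → ⊥-elim (irrN q≡q′ q<q′)))
    , (mk⇔ (λ p′<p → ⊥-elim (asymM p<p′ p′<p)) (λ q′<q → ⊥-elim (asymN q<q′ q′<q))
      , mk⇔ (λ p′≡p → ⊥-elim (irrM (sym p′≡p) p<p′)) (λ q′≡q → ⊥-elim (irrN (sym q′≡q) q<q′)))
    where
      irrM : ∀ {p p′} → p ≡ p′ → ¬ _≺_ M p p′
      irrM refl p<p = asymM p<p p<p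
      irrN : ∀ {q q′} → q ≡ q′ → ¬ _≺_ N q q′
      irrN refl q<q = asymN q<q q<q

BF-suc⇒BF : ∀ α {M N n} {a : Fin n → Carrier M} {b : Fin n → Carrier N} → BF (suc α) M a N b → BF α M a N b
BF-suc⇒BF zero {M} {N} {a = a} {b} step with step 0 []
... | c , agree = SameAtomic-sym {N} {M} (Pairwise-reindex {Q = AtomicAgree N M} (_↑ˡ 0)
                    (λ i → sym (lookup-++ˡ b [] i)) (λ i → sym (lookup-++ˡ a c i)) agree)
BF-suc⇒BF (suc α) = proj₂

Step⇒BF : ∀ β {M N n} {a : Fin n → Carrier M} {b : Fin n → Carrier N} → Step β M a N b → BF (suc β) M a N b
Step⇒BF zero    step = step
Step⇒BF (suc β) step = step , Step⇒BF β (λ m d → let c , bf = step m d in c , BF-suc⇒BF β bf)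

-- Finite cuts in a strict total order

module _ {A : Set} {_<_ : A → A → Set} (sto : IsStrictTotalOrder _≡_ _<_) where
  open IsStrictTotalOrder sto using (compare) renaming (trans to <-trans)

  ≤-<-trans : ∀ {x y z} → x < y ⊎ x ≡ y → y < z → x < z
  ≤-<-trans (inj₁ x<y)  y<z = <-trans x<y y<z
  ≤-<-trans (inj₂ refl) y<z = y<z

  <-≤-trans : ∀ {x y z} → x < y → y < z ⊎ y ≡ z → x < z
  <-≤-trans x<y (inj₁ y<z)  = <-trans x<y y<z
  <-≤-trans x<y (inj₂ refl) = x<y

  ≢-≮⇒> : ∀ {x y} → x ≢ y → ¬ x < y → y < x
  ≢-≮⇒> {x} {y} x≢y x≮y with compare x y
  ... | tri< x<y _ _ = ⊥-elim (x≮y x<y)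
  ... | tri≈ _ x≡y _ = ⊥-elim (x≢y x≡y)
  ... | tri> _ _ y<x = y<x

  greatest : ∀ {n} (a : Fin n → A) {P : Fin n → Set} → (∀ i → Dec (P i)) →
             (∀ i → ¬ P i) ⊎ ∃[ j ] P j × (∀ i → P i → a i < a j ⊎ a i ≡ a j)
  greatest {zero}  a P? = inj₁ λ ()
  greatest {suc n} a P? with greatest (a ∘ suc) (P? ∘ suc) | P? zero
  ... | inj₁ none | no ¬p₀ = inj₁ λ { zero → ¬p₀ ; (suc i) → none i }
  ... | inj₁ none | yes p₀ = inj₂ (zero , p₀ , λ { zero _ → inj₂ refl ; (suc i) pᵢ → ⊥-elim (none i pᵢ) })
  ... | inj₂ (j , pⱼ , max) | no ¬p₀ = inj₂ (suc j , pⱼ , λ { zero p₀ → ⊥-elim (¬p₀ p₀) ; (suc i) → max i })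
  ... | inj₂ (j , pⱼ , max) | yes p₀ with compare (a zero) (a (suc j))
  ...   | tri< a₀<aⱼ _ _ = inj₂ (suc j , pⱼ , λ { zero _ → inj₁ a₀<aⱼ ; (suc i) → max i })
  ...   | tri≈ _ a₀≡aⱼ _ = inj₂ (suc j , pⱼ , λ { zero _ → inj₂ a₀≡aⱼ ; (suc i) → max i })
  ...   | tri> _ _ aⱼ<a₀ =
    inj₂ (zero , p₀ , λ { zero _ → inj₂ refl ; (suc i) pᵢ → inj₁ (≤-<-trans (max i pᵢ) aⱼ<a₀) })

module _ {A : Set} {_<_ : A → A → Set} (sto : IsStrictTotalOrder _≡_ _<_) where
  open Strict± _<_ using (_<±_; [<]-injective; ⊥±<[_]; [_]<⊤±; ⊥±<⊤±) renaming ([_] to [_]±)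

  private
    sto⁻¹ : IsStrictTotalOrder _≡_ (flip _<_)
    sto⁻¹ = Flip.isStrictTotalOrder sto

  least : ∀ {n} (a : Fin n → A) {P : Fin n → Set} → (∀ i → Dec (P i)) →
          (∀ i → ¬ P i) ⊎ ∃[ j ] P j × (∀ i → P i → a j < a i ⊎ a j ≡ a i)
  least a P? = Sum.map₂ (Product.map₂ (Product.map₂ λ min i pᵢ → Sum.map₂ sym (min i pᵢ))) (greatest sto⁻¹ a P?)

  module _ {n} (a : Fin n → A) {L : Fin n → Set} where

    private
      below : ∀ l → (∀ i → L i → a i < a l ⊎ a i ≡ a l) → ∀ {z} → [ a l ] <± [ z ] → ∀ i → L i → a i < z
      below l max l<z i lᵢ = ≤-<-trans sto (max i lᵢ) ([<]-injective l<z)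

      above : ∀ u → (∀ i → ¬ L i → a u < a i ⊎ a u ≡ a i) → ∀ {z} → [ z ] <± [ a u ] → ∀ i → ¬ L i → z < a i
      above u min z<u i rᵢ = <-≤-trans sto ([<]-injective z<u) (min i rᵢ)

    separatingInterval : (∀ i → Dec (L i)) → (∀ i j → L i → ¬ L j → a i < a j) →
      Σ (A ±) λ lo → Σ (A ±) λ hi → lo <± hi ×
        (∀ {z} → lo <± [ z ] → ∀ i → L i → a i < z) × (∀ {z} → [ z ] <± hi → ∀ i → ¬ L i → z < a i)
    separatingInterval L? sep with greatest sto a L? | least a (¬? ∘ L?)
    ... | inj₁ noL | inj₁ noR = ⊥± , ⊤± , ⊥±<⊤± , (λ _ i l → ⊥-elim (noL i l)) , (λ _ i r → ⊥-elim (noR i r))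
    ... | inj₁ noL | inj₂ (u , rᵤ , min) =
      ⊥± , [ a u ] , ⊥±<[ a u ] , (λ _ i l → ⊥-elim (noL i l)) , above u min
    ... | inj₂ (l , lₗ , max) | inj₁ noR =
      [ a l ] , ⊤± , [ a l ]<⊤± , below l max , (λ _ i r → ⊥-elim (noR i r))
    ... | inj₂ (l , lₗ , max) | inj₂ (u , rᵤ , min) =
      [ a l ] , [ a u ] , [ sep l u lₗ rᵤ ]± , below l max , above u min

-- Block orders

-- nothing is an ω-block, just k a block with the k+1 positions 0,…,k.
Size : Set
Size = Maybe ℕ

infix 4 _<ˢ_ _≤ˢ_

_<ˢ_ : ℕ → Size → Set
n <ˢ nothing = ⊤
n <ˢ just k  = n < suc k

_≤ˢ_ : Size → Size → Set
just a  ≤ˢ just b  = a ≤ b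
nothing ≤ˢ just _  = ⊥
_       ≤ˢ nothing = ⊤

≤ˢ-refl : ∀ s → s ≤ˢ s
≤ˢ-refl (just a) = ℕ.≤-refl
≤ˢ-refl nothing  = tt

<ˢ-mono : ∀ {n s t} → n <ˢ s → s ≤ˢ t → n <ˢ t
<ˢ-mono {s = just a}  {just b}  n<s a≤b = ℕ.≤-trans n<s (s≤s a≤b)
<ˢ-mono {s = just a}  {nothing} _   _   = tt
<ˢ-mono {s = nothing} {nothing} _   _   = tt

<ˢ-downward : ∀ {m n} s → m < n → n <ˢ s → m <ˢ s
<ˢ-downward nothing  _   _   = tt
<ˢ-downward (just k) m<n n<s = ℕ.<-trans m<n n<s

0<ˢ : ∀ s → 0 <ˢ s
0<ˢ nothing  = tt
0<ˢ (just k) = s≤s z≤n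

-- A linear order presented as an ordered set of blocks, each block being
-- an initial segment of ω of the given size.
record BlockOrder : Set₁ where
  field
    Point       : Set
    _⊏_         : Point → Point → Set
    Block       : Set
    _<ᴮ_        : Block → Block → Set
    <ᴮ-isSTO    : IsStrictTotalOrder _≡_ _<ᴮ_
    size        : Block → Size
    block       : Point → Block
    pos         : Point → ℕ
    point       : (b : Block) (n : ℕ) → n <ˢ size b → Point
    block-point : ∀ b n n<s → block (point b n n<s) ≡ b
    pos-point   : ∀ b n n<s → pos (point b n n<s) ≡ n
    pos<size    : ∀ p → pos p <ˢ size (block p)
    ⊏-inv       : ∀ {p q} → p ⊏ q → block p <ᴮ block q ⊎ (block p ≡ block q × pos p < pos q)
    ⊏-block     : ∀ {p q} → block p <ᴮ block q → p ⊏ q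
    ⊏-pos       : ∀ {p q} → block p ≡ block q → pos p < pos q → p ⊏ q
    point-ext   : ∀ {p q} → block p ≡ block q → pos p ≡ pos q → p ≡ q

  module ᴮ = IsStrictTotalOrder <ᴮ-isSTO

  ⊏-trans : ∀ {p q r} → p ⊏ q → q ⊏ r → p ⊏ r
  ⊏-trans {p} {q} {r} p⊏q q⊏r with ⊏-inv p⊏q | ⊏-inv q⊏r
  ... | inj₁ p<q        | inj₁ q<r        = ⊏-block (ᴮ.trans p<q q<r)
  ... | inj₁ p<q        | inj₂ (q≡r , _)  = ⊏-block (subst (block p <ᴮ_) q≡r p<q)
  ... | inj₂ (p≡q , _)  | inj₁ q<r        = ⊏-block (subst (_<ᴮ block r) (sym p≡q) q<r)
  ... | inj₂ (p≡q , p<q) | inj₂ (q≡r , q<r) = ⊏-pos (trans p≡q q≡r) (ℕ.<-trans p<q q<r)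

  ⊏-irrefl : ∀ {p} → ¬ p ⊏ p
  ⊏-irrefl p⊏p with ⊏-inv p⊏p
  ... | inj₁ p<p       = ᴮ.irrefl refl p<p
  ... | inj₂ (_ , p<p) = ℕ.<-irrefl refl p<p

  ⊏-asym : ∀ {p q} → p ⊏ q → ¬ q ⊏ p
  ⊏-asym p⊏q q⊏p = ⊏-irrefl (⊏-trans p⊏q q⊏p)

  private
    tri⊏ : ∀ {p q} → p ⊏ q → Tri (p ⊏ q) (p ≡ q) (q ⊏ p)
    tri⊏ p⊏q = tri< p⊏q (λ { refl → ⊏-irrefl p⊏q }) (⊏-asym p⊏q)

    tri⊐ : ∀ {p q} → q ⊏ p → Tri (p ⊏ q) (p ≡ q) (q ⊏ p)
    tri⊐ q⊏p = tri> (⊏-asym q⊏p) (λ { refl → ⊏-irrefl q⊏p }) q⊏p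

  ⊏-compare : ∀ p q → Tri (p ⊏ q) (p ≡ q) (q ⊏ p)
  ⊏-compare p q with ᴮ.compare (block p) (block q)
  ... | tri< p<q _ _ = tri⊏ (⊏-block p<q)
  ... | tri> _ _ q<p = tri⊐ (⊏-block q<p)
  ... | tri≈ _ p≡q _ with ℕ.<-cmp (pos p) (pos q)
  ...   | tri< p<q _ _ = tri⊏ (⊏-pos p≡q p<q)
  ...   | tri> _ _ q<p = tri⊐ (⊏-pos (sym p≡q) q<p)
  ...   | tri≈ _ p≡q′ _ with point-ext p≡q p≡q′
  ...     | refl = tri≈ ⊏-irrefl refl ⊏-irrefl

  ⊏-isSTO : IsStrictTotalOrder _≡_ _⊏_
  ⊏-isSTO = isStrictTotalOrderᶜ record { isEquivalence = isEquivalence ; trans = ⊏-trans ; compare = ⊏-compare }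

  module ᴾ = IsStrictTotalOrder ⊏-isSTO

  block-mono : ∀ {p q} → p ⊏ q ⊎ p ≡ q → block p <ᴮ block q ⊎ block p ≡ block q
  block-mono (inj₂ refl) = inj₂ refl
  block-mono (inj₁ p⊏q) with ⊏-inv p⊏q
  ... | inj₁ p<q       = inj₁ p<q
  ... | inj₂ (p≡q , _) = inj₂ p≡q

  ⊏-between : ∀ {p q r} → p ⊏ q → q ⊏ r → block p ≡ block r → block p ≡ block q × pos p < pos q × pos q < pos r
  ⊏-between {p} {q} {r} p⊏q q⊏r p≡r with ⊏-inv p⊏q | ⊏-inv q⊏r
  ... | inj₂ (p≡q , p<q) | inj₂ (_ , q<r) = p≡q , p<q , q<r
  ... | inj₁ p<q         | inj₁ q<r       = ⊥-elim (ᴮ.irrefl p≡r (ᴮ.trans p<q q<r))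
  ... | inj₁ p<q         | inj₂ (q≡r , _) = ⊥-elim (ᴮ.irrefl p≡r (subst (block p <ᴮ_) q≡r p<q))
  ... | inj₂ (p≡q , _)   | inj₁ q<r       = ⊥-elim (ᴮ.irrefl p≡r (subst (_<ᴮ block r) (sym p≡q) q<r))

toLO : BlockOrder → LO
toLO V = record { Carrier = BlockOrder.Point V ; _≺_ = BlockOrder._⊏_ V }

blockLO : BlockOrder → LO
blockLO V = record { Carrier = BlockOrder.Block V ; _≺_ = BlockOrder._<ᴮ_ V }

record BlocksDense (V : BlockOrder) (P : Size → Set) : Set where
  constructor blocksDense
  open BlockOrder V
  open Strict± _<ᴮ_ using (_<±_)
  field
    blockBetween : ∀ {lo hi} → lo <± hi → Σ Block λ z → lo <± [ z ] × [ z ] <± hi × P (size z)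

open BlocksDense public

module _ (V : BlockOrder) where
  open BlockOrder V

  BlocksDense-weaken : ∀ {P Q : Size → Set} → (∀ {s} → P s → Q s) → BlocksDense V P → BlocksDense V Q
  BlocksDense-weaken P⇒Q dense = blocksDense λ lo<hi →
    let z , lo<z , z<hi , pz = blockBetween dense lo<hi in z , lo<z , z<hi , P⇒Q pz

  fillCut : ∀ {P n} → BlocksDense V P → (b : Fin n → Block) {L : Fin n → Set} → (∀ i → Dec (L i)) →
            (∀ i j → L i → ¬ L j → b i <ᴮ b j) →
            Σ Block λ z → (∀ i → L i → b i <ᴮ z) × (∀ i → ¬ L i → z <ᴮ b i) × P (size z)
  fillCut dense b L? sep with separatingInterval <ᴮ-isSTO b L? sep
  ... | lo , hi , lo<hi , lo<⇒ , <hi⇒ with blockBetween dense lo<hi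
  ...   | z , lo<z , z<hi , pz = z , lo<⇒ lo<z , <hi⇒ z<hi , pz

toPos : (s : Size) → Carrier (colSh1 s) → ℕ
toPos nothing  i = i
toPos (just k) i = toℕ i

fromPos : (s : Size) (n : ℕ) → n <ˢ s → Carrier (colSh1 s)
fromPos nothing  n _   = n
fromPos (just k) n n<s = fromℕ< n<s

toPos-fromPos : ∀ s n n<s → toPos s (fromPos s n n<s) ≡ n
toPos-fromPos nothing  n _   = refl
toPos-fromPos (just k) n n<s = toℕ-fromℕ< n<s

toPos<size : ∀ s i → toPos s i <ˢ s
toPos<size nothing  i = tt
toPos<size (just k) i = toℕ<n i

toPos-injective : ∀ s {i j} → toPos s i ≡ toPos s j → i ≡ j
toPos-injective nothing  i≡j = i≡j
toPos-injective (just k) i≡j = toℕ-injective i≡j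

toPos-≺ : ∀ s {i j} → _≺_ (colSh1 s) i j → toPos s i < toPos s j
toPos-≺ nothing  i<j = i<j
toPos-≺ (just k) i<j = i<j

≺-toPos : ∀ s {i j} → toPos s i < toPos s j → _≺_ (colSh1 s) i j
≺-toPos nothing  i<j = i<j
≺-toPos (just k) i<j = i<j

module _ {C : Set} (κ : C → Size) (D : ColoredDense C) where
  open ColoredDense D renaming (_<_ to _<ᴰ_)

  private
    F : C → LO
    F = colSh1 ∘ κ

    posSh : ShCarrier D F → ℕ
    posSh (x , i) = toPos (κ (color x)) i

    ShLt-inv : ∀ {p q} → ShLt D F p q → proj₁ p <ᴰ proj₁ q ⊎ (proj₁ p ≡ proj₁ q × posSh p < posSh q)
    ShLt-inv (outer x<y)       = inj₁ x<y
    ShLt-inv (inner {x} i<j)   = inj₂ (refl , toPos-≺ (κ (color x)) i<j)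

    ShLt-pos : ∀ {p q} → proj₁ p ≡ proj₁ q → posSh p < posSh q → ShLt D F p q
    ShLt-pos {x , i} refl i<j = inner (≺-toPos (κ (color x)) i<j)

    Sh-ext : ∀ {p q} → proj₁ p ≡ proj₁ q → posSh p ≡ posSh q → p ≡ q
    Sh-ext {x , i} refl i≡j = cong (x ,_) (toPos-injective (κ (color x)) i≡j)

  shuffleBlocks : BlockOrder
  shuffleBlocks = record
    { Point       = ShCarrier D F
    ; _⊏_         = ShLt D F
    ; Block       = Pt
    ; _<ᴮ_        = _<ᴰ_
    ; <ᴮ-isSTO    = isSTO
    ; size        = κ ∘ color
    ; block       = proj₁
    ; pos         = posSh
    ; point       = λ x n n<s → x , fromPos (κ (color x)) n n<s
    ; block-point = λ _ _ _ → refl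
    ; pos-point   = λ x → toPos-fromPos (κ (color x))
    ; pos<size    = λ (x , i) → toPos<size (κ (color x)) i
    ; ⊏-inv       = ShLt-inv
    ; ⊏-block     = outer
    ; ⊏-pos       = ShLt-pos
    ; point-ext   = Sh-ext
    }

  open Strict± _<ᴰ_ using (_<±_; ⊥±<[_]; [_]<⊤±; ⊥±<⊤±) renaming ([_] to [_]±)

  shuffleBlocks-dense : ∀ c → BlocksDense shuffleBlocks (_≡ κ c)
  shuffleBlocks-dense c = blocksDense fill
    where
    fill : ∀ {lo hi} → lo <± hi → Σ Pt λ z → lo <± [ z ] × [ z ] <± hi × κ (color z) ≡ κ c
    fill [ x<y ]± = let z , x<z , z<y , e = colorDense _ _ c x<y in z , [ x<z ]± , [ z<y ]± , cong κ e
    fill ⊥±<[ y ] = let x , x<y = noMin y ; z , _ , z<y , e = colorDense _ _ c x<y in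
      z , ⊥±<[ z ] , [ z<y ]± , cong κ e
    fill [ x ]<⊤± = let y , x<y = noMax x ; z , x<z , _ , e = colorDense _ _ c x<y in
      z , [ x<z ]± , [ z ]<⊤± , cong κ e
    fill ⊥±<⊤±   = let y , x<y = noMax (enum 0) ; z , _ , _ , e = colorDense _ _ c x<y in
      z , ⊥±<[ z ] , [ z ]<⊤± , cong κ e

module SumBlocks (A B : BlockOrder) where
  private
    module A = BlockOrder A
    module B = BlockOrder B

  Block : Set
  Block = A.Block ⊎ B.Block

  _<ᴮ_ : Block → Block → Set
  _<ᴮ_ = A._<ᴮ_ ⊎-< B._<ᴮ_

  <ᴮ-compare : ∀ a b → Tri (a <ᴮ b) (a ≡ b) (b <ᴮ a)
  <ᴮ-compare a b with IsStrictTotalOrder.compare (⊎-<-isStrictTotalOrder A.<ᴮ-isSTO B.<ᴮ-isSTO) a b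
  ... | tri< a<b a≢b b≮a = tri< a<b (a≢b ∘ ≡⇒Pointwise-≡) b≮a
  ... | tri≈ a≮b a≡b b≮a = tri≈ a≮b (Pointwise-≡⇒≡ a≡b) b≮a
  ... | tri> a≮b a≢b b<a = tri> a≮b (a≢b ∘ ≡⇒Pointwise-≡) b<a

  Point : Set
  Point = A.Point ⊎ B.Point

  _⊏_ : Point → Point → Set
  _⊏_ = SumLt (toLO A) (toLO B)

  size : Block → Size
  size = [ A.size , B.size ]′

  block : Point → Block
  block = Sum.map A.block B.block

  pos : Point → ℕ
  pos = [ A.pos , B.pos ]′

  point : (b : Block) (n : ℕ) → n <ˢ size b → Point
  point (inj₁ b) n n<s = inj₁ (A.point b n n<s)
  point (inj₂ b) n n<s = inj₂ (B.point b n n<s)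

  block-point : ∀ b n n<s → block (point b n n<s) ≡ b
  block-point (inj₁ b) n n<s = cong inj₁ (A.block-point b n n<s)
  block-point (inj₂ b) n n<s = cong inj₂ (B.block-point b n n<s)

  pos-point : ∀ b n n<s → pos (point b n n<s) ≡ n
  pos-point (inj₁ b) = A.pos-point b
  pos-point (inj₂ b) = B.pos-point b

  pos<size : ∀ p → pos p <ˢ size (block p)
  pos<size (inj₁ p) = A.pos<size p
  pos<size (inj₂ p) = B.pos<size p

  ⊏-inv : ∀ {p q} → p ⊏ q → block p <ᴮ block q ⊎ (block p ≡ block q × pos p < pos q)
  ⊏-inv (ll p⊏q) = Sum.map ₁∼₁ (Product.map₁ (cong inj₁)) (A.⊏-inv p⊏q)
  ⊏-inv (rr p⊏q) = Sum.map ₂∼₂ (Product.map₁ (cong inj₂)) (B.⊏-inv p⊏q)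
  ⊏-inv lr       = inj₁ ₁∼₂

  ⊏-block : ∀ {p q} → block p <ᴮ block q → p ⊏ q
  ⊏-block {inj₁ _} {inj₁ _} (₁∼₁ p<q) = ll (A.⊏-block p<q)
  ⊏-block {inj₁ _} {inj₂ _} ₁∼₂       = lr
  ⊏-block {inj₂ _} {inj₂ _} (₂∼₂ p<q) = rr (B.⊏-block p<q)

  ⊏-pos : ∀ {p q} → block p ≡ block q → pos p < pos q → p ⊏ q
  ⊏-pos {inj₁ _} {inj₁ _} p≡q p<q = ll (A.⊏-pos (inj₁-injective p≡q) p<q)
  ⊏-pos {inj₂ _} {inj₂ _} p≡q p<q = rr (B.⊏-pos (inj₂-injective p≡q) p<q)

  point-ext : ∀ {p q} → block p ≡ block q → pos p ≡ pos q → p ≡ q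
  point-ext {inj₁ _} {inj₁ _} p≡q e = cong inj₁ (A.point-ext (inj₁-injective p≡q) e)
  point-ext {inj₂ _} {inj₂ _} p≡q e = cong inj₂ (B.point-ext (inj₂-injective p≡q) e)

  blocks : BlockOrder
  blocks = record
    { Point = Point ; _⊏_ = _⊏_ ; Block = Block ; _<ᴮ_ = _<ᴮ_
    ; <ᴮ-isSTO = isStrictTotalOrderᶜ record
        { isEquivalence = isEquivalence ; trans = ⊎-<-transitive A.ᴮ.trans B.ᴮ.trans ; compare = <ᴮ-compare }
    ; size = size ; block = block ; pos = pos ; point = point ; block-point = block-point ; pos-point = pos-point
    ; pos<size = pos<size ; ⊏-inv = ⊏-inv ; ⊏-block = ⊏-block ; ⊏-pos = ⊏-pos ; point-ext = point-ext
    }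

_⊕ᴮ_ : BlockOrder → BlockOrder → BlockOrder
A ⊕ᴮ B = SumBlocks.blocks A B

module _ {A B : BlockOrder} {P : Size → Set} where
  open Strict± (BlockOrder._<ᴮ_ A) using (⊥±<[_]; [_]<⊤±; ⊥±<⊤±) renaming ([_] to [_]±)

  ⊕ᴮ-dense : BlocksDense A P → BlocksDense B P → BlocksDense (A ⊕ᴮ B) P
  ⊕ᴮ-dense (blocksDense denseA) (blocksDense denseB) = blocksDense fill
    where
    open Strict± (SumBlocks._<ᴮ_ A B) using (_<±_)
    fill : ∀ {lo hi} → lo <± hi → Σ (SumBlocks.Block A B) λ z → lo <± [ z ] × [ z ] <± hi × P (SumBlocks.size A B z)
    fill [ ₁∼₁ a<b ]± with denseA [ a<b ]±
    ... | z , [ a<z ]± , [ z<b ]± , pz = inj₁ z , [ ₁∼₁ a<z ]± , [ ₁∼₁ z<b ]± , pz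
    fill [ ₂∼₂ a<b ]± with denseB [ a<b ]±
    ... | z , [ a<z ]± , [ z<b ]± , pz = inj₂ z , [ ₂∼₂ a<z ]± , [ ₂∼₂ z<b ]± , pz
    fill [ ₁∼₂ {a} ]± with denseA [ a ]<⊤±
    ... | z , [ a<z ]± , _ , pz = inj₁ z , [ ₁∼₁ a<z ]± , [ ₁∼₂ ]± , pz
    fill ⊥±<[ inj₁ b ] with denseA ⊥±<[ b ]
    ... | z , _ , [ z<b ]± , pz = inj₁ z , ⊥±<[ inj₁ z ] , [ ₁∼₁ z<b ]± , pz
    fill ⊥±<[ inj₂ b ] with denseB ⊥±<[ b ]
    ... | z , _ , [ z<b ]± , pz = inj₂ z , ⊥±<[ inj₂ z ] , [ ₂∼₂ z<b ]± , pz
    fill [ inj₁ a ]<⊤± with denseA [ a ]<⊤±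
    ... | z , [ a<z ]± , _ , pz = inj₁ z , [ ₁∼₁ a<z ]± , [ inj₁ z ]<⊤± , pz
    fill [ inj₂ a ]<⊤± with denseB [ a ]<⊤±
    ... | z , [ a<z ]± , _ , pz = inj₂ z , [ ₂∼₂ a<z ]± , [ inj₂ z ]<⊤± , pz
    fill ⊥±<⊤± with denseA ⊥±<⊤±
    ... | z , _ , _ , pz = inj₁ z , ⊥±<[ inj₁ z ] , [ inj₁ z ]<⊤± , pz

-- Matchings

module _ (V W : BlockOrder) where
  private
    module V = BlockOrder V
    module W = BlockOrder W

  BlocksAgree : V.Point → W.Point → V.Point → W.Point → Set
  BlocksAgree p q p′ q′ = AtomicAgree (blockLO V) (blockLO W) (V.block p) (W.block q) (V.block p′) (W.block q′)

  record Matching (R : Size → Size → Set) {n} (x : Fin n → V.Point) (y : Fin n → W.Point) : Set where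
    field
      samePos    : ∀ i → V.pos (x i) ≡ W.pos (y i)
      sameBlocks : Pairwise BlocksAgree x y
      sizes      : ∀ i → R (V.size (V.block (x i))) (W.size (W.block (y i)))

  open Matching public

  module _ {R : Size → Size → Set} where

    Matching-reindex : Reindexable (Matching R)
    Matching-reindex {x = x} {y} {x′} {y′} ρ x′≗ y′≗ m = record
      { samePos    = λ i → subst₂ (λ p q → V.pos p ≡ W.pos q) (sym (x′≗ i)) (sym (y′≗ i)) (samePos m (ρ i))
      ; sameBlocks = Pairwise-reindex {Q = BlocksAgree} ρ x′≗ y′≗ (sameBlocks m)
      ; sizes      = λ i → subst₂ (λ p q → R (V.size (V.block p)) (W.size (W.block q))) (sym (x′≗ i)) (sym (y′≗ i))
                       (sizes m (ρ i))
      }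

    Matching-weaken : ∀ {R′ n} {x : Fin n → V.Point} {y} → (∀ {s t} → R s t → R′ s t) →
                      Matching R x y → Matching R′ x y
    Matching-weaken R⇒R′ m = record { samePos = samePos m ; sameBlocks = sameBlocks m ; sizes = R⇒R′ ∘ sizes m }

    Matching-∷ : ∀ {n} {x : Fin n → V.Point} {y} {f e} → Matching R x y → V.pos f ≡ W.pos e →
      R (V.size (V.block f)) (W.size (W.block e)) →
      (∀ i → BlocksAgree f e (x i) (y i) × BlocksAgree (x i) (y i) f e) →
      Matching R (f ∷ x) (e ∷ y)
    Matching-∷ m f≡e r agree = record
      { samePos    = λ { zero → f≡e ; (suc i) → samePos m i }
      ; sameBlocks = Pairwise-∷ {Q = BlocksAgree} (sameBlocks m)
          (mk⇔ (⊥-elim ∘ V.ᴮ.irrefl refl) (⊥-elim ∘ W.ᴮ.irrefl refl) , mk⇔ (λ _ → refl) (λ _ → refl))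
          agree
      ; sizes      = λ { zero → r ; (suc i) → sizes m i }
      }

    ⊏-transfer : ∀ {n} {x : Fin n → V.Point} {y} → Matching R x y → ∀ i j → x i V.⊏ x j → y i W.⊏ y j
    ⊏-transfer m i j xᵢ⊏xⱼ with V.⊏-inv xᵢ⊏xⱼ
    ... | inj₁ b<b         = W.⊏-block (Equivalence.to (proj₁ (sameBlocks m i j)) b<b)
    ... | inj₂ (b≡b , p<p) = W.⊏-pos (Equivalence.to (proj₂ (sameBlocks m i j)) b≡b)
                                     (subst₂ _<_ (samePos m i) (samePos m j) p<p)

    ≡-transfer : ∀ {n} {x : Fin n → V.Point} {y} → Matching R x y → ∀ i j → x i ≡ x j → y i ≡ y j
    ≡-transfer m i j xᵢ≡xⱼ = W.point-ext (Equivalence.to (proj₂ (sameBlocks m i j)) (cong V.block xᵢ≡xⱼ))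
                                         (trans (sym (samePos m i)) (trans (cong V.pos xᵢ≡xⱼ) (samePos m j)))

Matching-sym : ∀ {V W R n} {x : Fin n → BlockOrder.Point V} {y} → Matching V W R x y → Matching W V (flip R) y x
Matching-sym {V} {W} m = record
  { samePos = sym ∘ samePos m ; sameBlocks = SameAtomic-sym {blockLO V} {blockLO W} (sameBlocks m) ; sizes = sizes m }

Matching⇒SameAtomic : ∀ {V W R n} {x : Fin n → BlockOrder.Point V} {y} → Matching V W R x y →
                       SameAtomic (toLO V) x (toLO W) y
Matching⇒SameAtomic m i j =
  mk⇔ (⊏-transfer _ _ m i j) (⊏-transfer _ _ (Matching-sym m) i j) ,
  mk⇔ (≡-transfer _ _ m i j) (≡-transfer _ _ (Matching-sym m) i j)

module MatchingMove (V W : BlockOrder) (R : Size → Size → Set) (dense : ∀ s → BlocksDense V (λ t → R t s))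
                    (bound : ℕ) (fit : ∀ {s t n} → R s t → n <ˢ t → n < bound → n <ˢ s) where
  private
    module V = BlockOrder V
    module W = BlockOrder W

  freshBlock : ∀ {n} {x : Fin n → V.Point} {y} → Matching V W R x y → ∀ e → W.pos e < bound →
               (∀ j → W.block (y j) ≢ W.block e) → Σ V.Point λ f → Matching V W R (f ∷ x) (e ∷ y)
  freshBlock {x = x} {y} m e e<bound e∉y
    with fillCut V {P = λ t → R t (W.size (W.block e))} (dense (W.size (W.block e)))
           (V.block ∘ x) (λ j → W.block (y j) W.ᴮ.<? W.block e)
           (λ i j yᵢ<e yⱼ≮e → Equivalence.from (proj₁ (sameBlocks m i j))
                                 (W.ᴮ.trans yᵢ<e (≢-≮⇒> W.<ᴮ-isSTO (e∉y j) yⱼ≮e)))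
  ... | z , below , above , Rz = f , Matching-∷ V W m (V.pos-point z _ fits) sizeᶠ agree
    where
      fits = fit Rz (W.pos<size e) e<bound
      f = V.point z (W.pos e) fits
      sizeᶠ : R (V.size (V.block f)) (W.size (W.block e))
      sizeᶠ rewrite V.block-point z _ fits = Rz
      agree : ∀ j → BlocksAgree V W f e (x j) (y j) × BlocksAgree V W (x j) (y j) f e
      agree j rewrite V.block-point z _ fits with W.block (y j) W.ᴮ.<? W.block e
      ... | yes yⱼ<e = Product.swap (AtomicAgree-< {blockLO V} {blockLO W} V.ᴮ.asym W.ᴮ.asym (below j yⱼ<e) yⱼ<e)
      ... | no  yⱼ≮e =
        AtomicAgree-< {blockLO V} {blockLO W} V.ᴮ.asym W.ᴮ.asym (above j yⱼ≮e) (≢-≮⇒> W.<ᴮ-isSTO (e∉y j) yⱼ≮e)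

  extend₁ : ∀ {n} {x : Fin n → V.Point} {y} → Matching V W R x y →
            ∀ e → W.pos e < bound → Σ V.Point λ f → Matching V W R (f ∷ x) (e ∷ y)
  extend₁ {n} {x} {y} m e e<bound with any? (λ i → W.block (y i) W.ᴮ.≟ W.block e)
  ... | yes (i , yᵢ≡e) = f , Matching-∷ V W m (V.pos-point _ _ fits) sizeᶠ agree
    where
      fits : W.pos e <ˢ V.size (V.block (x i))
      fits = fit (sizes m i) (subst (λ b → W.pos e <ˢ W.size b) (sym yᵢ≡e) (W.pos<size e)) e<bound
      f = V.point (V.block (x i)) (W.pos e) fits
      sizeᶠ : R (V.size (V.block f)) (W.size (W.block e))
      sizeᶠ rewrite V.block-point _ _ fits | sym yᵢ≡e = sizes m i
      agree : ∀ j → BlocksAgree V W f e (x j) (y j) × BlocksAgree V W (x j) (y j) f e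
      agree j rewrite V.block-point _ _ fits | sym yᵢ≡e = sameBlocks m i j , sameBlocks m j i
  ... | no e∉y = freshBlock m e e<bound (λ j yⱼ≡e → e∉y (j , yⱼ≡e))

  extend : ∀ m {n} {x : Fin n → V.Point} {y} → Matching V W R x y → (d : Fin m → W.Point) →
           (∀ k → W.pos (d k) < bound) → Σ (Fin m → V.Point) λ c → Matching V W R (x ++ c) (y ++ d)
  extend = extendAll (Matching V W R) (Matching-reindex V W) (λ e → W.pos e < bound) extend₁

-- Gaps

infix 4 _⇥_≼_⇥_

-- b − a ≤ d − c, stated without truncated subtraction.
data _⇥_≼_⇥_ (a b c d : ℕ) : Set where
  mk≼ : b + c ≤ d + a → a ⇥ b ≼ c ⇥ d

≼-refl : ∀ a b → a ⇥ b ≼ a ⇥ b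
≼-refl a b = mk≼ ℕ.≤-refl

≼-empty : ∀ a c → a ⇥ a ≼ c ⇥ c
≼-empty a c = mk≼ (ℕ.≤-reflexive (ℕ.+-comm a c))

≼-shift : ∀ a c δ → a ⇥ a + δ ≼ c ⇥ c + δ
≼-shift a c δ = mk≼ (ℕ.≤-reflexive (shift a c δ))
  where
    shift : ∀ a c δ → a + δ + c ≡ c + δ + a
    shift = solve-∀

≼-dropˡ : ∀ {a b c d} δ → a ⇥ b ≼ c ⇥ d → a + δ ⇥ b ≼ c + δ ⇥ d
≼-dropˡ {a} {b} {c} {d} δ (mk≼ b+c≤d+a) =
  mk≼ (subst₂ _≤_ (ℕ.+-assoc b c δ) (ℕ.+-assoc d a δ) (ℕ.+-monoˡ-≤ δ b+c≤d+a))

≼-trans : ∀ {a b c d b′ d′} → a ⇥ b ≼ c ⇥ d → b ⇥ b′ ≼ d ⇥ d′ → a ⇥ b′ ≼ c ⇥ d′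
≼-trans {a} {b} {c} {d} {b′} {d′} (mk≼ b+c≤d+a) (mk≼ b′+d≤d′+b) = mk≼
  (ℕ.+-cancelʳ-≤ (b + d) (b′ + c) (d′ + a)
    (subst₂ _≤_ (regroupˡ b′ d b c) (regroupʳ d′ b d a) (ℕ.+-mono-≤ b′+d≤d′+b b+c≤d+a)))
  where
    regroupˡ : ∀ b′ d b c → (b′ + d) + (b + c) ≡ (b′ + c) + (b + d)
    regroupˡ = solve-∀
    regroupʳ : ∀ d′ b d a → (d′ + b) + (d + a) ≡ (d′ + a) + (b + d)
    regroupʳ = solve-∀

≼-< : ∀ {a b c d} → a ⇥ b ≼ c ⇥ d → a < b → c < d
≼-< {a} {b} {c} {d} (mk≼ b+c≤d+a) a<b =
  ℕ.+-cancelʳ-< a c d (ℕ.<-≤-trans (subst (c + a <_) (ℕ.+-comm c b) (ℕ.+-monoʳ-< c a<b)) b+c≤d+a)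

module _ (V W : BlockOrder) where
  private
    module V = BlockOrder V
    module W = BlockOrder W

  GapBound : V.Point → W.Point → V.Point → W.Point → Set
  GapBound p q p′ q′ = V.block p ≡ V.block p′ → W.block q ≡ W.block q′ × W.pos q ⇥ W.pos q′ ≼ V.pos p ⇥ V.pos p′

  record GapAgree (p : V.Point) (q : W.Point) (p′ : V.Point) (q′ : W.Point) : Set where
    constructor gapAgree
    field
      atomic : AtomicAgree (toLO V) (toLO W) p q p′ q′
      gap    : p V.⊏ p′ → GapBound p q p′ q′

  open GapAgree public

  Gapped : ∀ {n} → (Fin n → V.Point) → (Fin n → W.Point) → Set
  Gapped = Pairwise GapAgree

  GapAgree-refl : ∀ p q → GapAgree p q p q
  GapAgree-refl p q = gapAgree (mk⇔ (⊥-elim ∘ V.⊏-irrefl) (⊥-elim ∘ W.⊏-irrefl) , mk⇔ (λ _ → refl) (λ _ → refl))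
                               (⊥-elim ∘ V.⊏-irrefl)

  Gapped-∷ : ∀ {n} {x : Fin n → V.Point} {y} {f e} → Gapped x y →
             (∀ i → GapAgree f e (x i) (y i) × GapAgree (x i) (y i) f e) → Gapped (f ∷ x) (e ∷ y)
  Gapped-∷ {f = f} {e} g = Pairwise-∷ {Q = GapAgree} g (GapAgree-refl f e)

  GapAgree-< : ∀ {p q p′ q′} → p V.⊏ p′ → q W.⊏ q′ → GapBound p q p′ q′ → GapAgree p q p′ q′ × GapAgree p′ q′ p q
  GapAgree-< p⊏p′ q⊏q′ bound =
    let agree , agree′ = AtomicAgree-< {toLO V} {toLO W} V.⊏-asym W.⊏-asym p⊏p′ q⊏q′
    in gapAgree agree (λ _ → bound) , gapAgree agree′ (λ p′⊏p → ⊥-elim (V.⊏-asym p⊏p′ p′⊏p))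

  Matching⇒Gapped : ∀ {R n} {x : Fin n → V.Point} {y} → Matching V W R x y → Gapped x y
  Matching⇒Gapped {x = x} {y} m i j = gapAgree (Matching⇒SameAtomic m i j) λ _ bᵢ≡bⱼ →
    Equivalence.to (proj₂ (sameBlocks m i j)) bᵢ≡bⱼ ,
    subst₂ (λ a c → W.pos (y i) ⇥ W.pos (y j) ≼ a ⇥ c) (sym (samePos m i)) (sym (samePos m j))
      (≼-refl (W.pos (y i)) (W.pos (y j)))

  Gapped⇒SameAtomic : ∀ {n} {x : Fin n → V.Point} {y} → Gapped x y → SameAtomic (toLO V) x (toLO W) y
  Gapped⇒SameAtomic g i j = atomic (g i j)

  GapBound-trans : ∀ {p q p′ q′ p″ q″} → V.block p ≡ V.block p′ →
                   GapBound p q p′ q′ → GapBound p′ q′ p″ q″ → GapBound p q p″ q″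
  GapBound-trans b≡b′ bound bound′ b≡b″ =
    let bq≡bq′ , gap₁ = bound b≡b′ ; bq′≡bq″ , gap₂ = bound′ (trans (sym b≡b′) b≡b″)
    in trans bq≡bq′ bq′≡bq″ , ≼-trans gap₁ gap₂

  GapBound-≤ : ∀ {n} {x : Fin n → V.Point} {y} → Gapped x y → ∀ {k l} → x k V.⊏ x l ⊎ x k ≡ x l →
               GapBound (x k) (y k) (x l) (y l)
  GapBound-≤ g {k} {l} (inj₁ xₖ⊏xₗ) = gap (g k l) xₖ⊏xₗ
  GapBound-≤ {x = x} {y} g {k} {l} (inj₂ xₖ≡xₗ) _ =
    cong W.block yₖ≡yₗ ,
    subst₂ (λ a b → W.pos a ⇥ W.pos (y l) ≼ V.pos b ⇥ V.pos (x l)) (sym yₖ≡yₗ) (sym xₖ≡xₗ) (≼-empty _ _)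
    where yₖ≡yₗ = Equivalence.to (proj₂ (atomic (g k l))) xₖ≡xₗ

module GapMove (V W : BlockOrder) (dense : BlocksDense V (λ _ → ⊤)) where
  private
    module V = BlockOrder V
    module W = BlockOrder W

  freshBlock : ∀ {n} {x : Fin n → V.Point} {y} → Gapped V W x y → ∀ e → (∀ j → y j ≢ e) →
               (∀ i j → y i W.⊏ e → ¬ y j W.⊏ e → V.block (x i) V.<ᴮ V.block (x j)) →
               Σ V.Point λ f → Gapped V W (f ∷ x) (e ∷ y)
  freshBlock {x = x} {y} g e e∉y separated with fillCut V dense (V.block ∘ x) (λ j → y j W.ᴾ.<? e) separated
  ... | z , below , above , _ = f , Gapped-∷ V W g agree
    where
      f = V.point z 0 (0<ˢ (V.size z))
      bᶠ : V.block f ≡ z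
      bᶠ = V.block-point z 0 (0<ˢ (V.size z))
      agree : ∀ j → GapAgree V W f e (x j) (y j) × GapAgree V W (x j) (y j) f e
      agree j with y j W.ᴾ.<? e
      ... | yes yⱼ⊏e = let xⱼ<f = subst (V.block (x j) V.<ᴮ_) (sym bᶠ) (below j yⱼ⊏e) in
        Product.swap (GapAgree-< V W (V.⊏-block xⱼ<f) yⱼ⊏e (λ xⱼ≡f → ⊥-elim (V.ᴮ.irrefl xⱼ≡f xⱼ<f)))
      ... | no  yⱼ⋢e = let f<xⱼ = subst (V._<ᴮ V.block (x j)) (sym bᶠ) (above j yⱼ⋢e) in
        GapAgree-< V W (V.⊏-block f<xⱼ) (≢-≮⇒> W.⊏-isSTO (e∉y j) yⱼ⋢e) (λ f≡xⱼ → ⊥-elim (V.ᴮ.irrefl f≡xⱼ f<xⱼ))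

  -- f is placed in the block of p at the offset of e from q.
  splitGap : ∀ {p q p′ q′ e} → q W.⊏ e → e W.⊏ q′ → V.block p ≡ V.block p′ → GapBound V W p q p′ q′ →
             Σ V.Point λ f → V.block f ≡ V.block p × p V.⊏ f × f V.⊏ p′ ×
                            GapBound V W p q f e × GapBound V W f e p′ q′
  splitGap {p} {q} {p′} {q′} {e} q⊏e e⊏q′ b≡b′ bound =
    f , bᶠ , V.⊏-pos (sym bᶠ) (≼-< gapˡ q<e) , V.⊏-pos (trans bᶠ b≡b′) (≼-< gapʳ e<q′) ,
    (λ _ → bq≡be , gapˡ) , (λ _ → trans (sym bq≡be) (proj₁ (bound b≡b′)) , gapʳ)
    where
      between = W.⊏-between q⊏e e⊏q′ (proj₁ (bound b≡b′))
      bq≡be = proj₁ between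
      q<e = proj₁ (proj₂ between)
      e<q′ = proj₂ (proj₂ between)
      δ = W.pos e ∸ W.pos q
      pₑ : W.pos q + δ ≡ W.pos e
      pₑ = ℕ.m+[n∸m]≡n (ℕ.<⇒≤ q<e)
      gapʳ′ : W.pos e ⇥ W.pos q′ ≼ V.pos p + δ ⇥ V.pos p′
      gapʳ′ = subst (λ a → a ⇥ W.pos q′ ≼ V.pos p + δ ⇥ V.pos p′) pₑ (≼-dropˡ δ (proj₂ (bound b≡b′)))
      fits : V.pos p + δ <ˢ V.size (V.block p)
      fits = <ˢ-downward _ (≼-< gapʳ′ e<q′) (subst (λ b → V.pos p′ <ˢ V.size b) (sym b≡b′) (V.pos<size p′))
      f = V.point (V.block p) (V.pos p + δ) fits
      bᶠ : V.block f ≡ V.block p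
      bᶠ = V.block-point _ _ fits
      pᶠ : V.pos f ≡ V.pos p + δ
      pᶠ = V.pos-point _ _ fits
      gapˡ : W.pos q ⇥ W.pos e ≼ V.pos p ⇥ V.pos f
      gapˡ = subst₂ (λ a b → W.pos q ⇥ a ≼ V.pos p ⇥ b) pₑ (sym pᶠ) (≼-shift _ _ δ)
      gapʳ : W.pos e ⇥ W.pos q′ ≼ V.pos f ⇥ V.pos p′
      gapʳ = subst (λ b → W.pos e ⇥ W.pos q′ ≼ b ⇥ V.pos p′) (sym pᶠ) gapʳ′

  inBlock : ∀ {n} {x : Fin n → V.Point} {y} → Gapped V W x y → ∀ e → (∀ j → y j ≢ e) → ∀ l u →
            y l W.⊏ e → (∀ k → y k W.⊏ e → x k V.⊏ x l ⊎ x k ≡ x l) →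
            e W.⊏ y u → (∀ k → e W.⊏ y k → x u V.⊏ x k ⊎ x u ≡ x k) →
            V.block (x l) ≡ V.block (x u) → Σ V.Point λ f → Gapped V W (f ∷ x) (e ∷ y)
  inBlock {x = x} {y} g e e∉y l u yₗ⊏e maxₗ e⊏yᵤ minᵤ bₗ≡bᵤ
    with splitGap yₗ⊏e e⊏yᵤ bₗ≡bᵤ (gap (g l u) (Equivalence.from (proj₁ (atomic (g l u))) (W.⊏-trans yₗ⊏e e⊏yᵤ)))
  ... | f , bᶠ , xₗ⊏f , f⊏xᵤ , boundₗ , boundᵤ = f , Gapped-∷ V W g agree
    where
      agree : ∀ k → GapAgree V W f e (x k) (y k) × GapAgree V W (x k) (y k) f e
      agree k with y k W.ᴾ.<? e
      ... | yes yₖ⊏e = Product.swap (GapAgree-< V W (≤-<-trans V.⊏-isSTO (maxₗ k yₖ⊏e) xₗ⊏f) yₖ⊏e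
                         (λ bₖ≡bᶠ → GapBound-trans V W (trans bₖ≡bᶠ bᶠ) (GapBound-≤ V W g (maxₗ k yₖ⊏e)) boundₗ bₖ≡bᶠ))
      ... | no  yₖ⋢e = let e⊏yₖ = ≢-≮⇒> W.⊏-isSTO (e∉y k) yₖ⋢e in
        GapAgree-< V W (<-≤-trans V.⊏-isSTO f⊏xᵤ (minᵤ k e⊏yₖ)) e⊏yₖ
          (GapBound-trans V W (trans bᶠ bₗ≡bᵤ) boundᵤ (GapBound-≤ V W g (minᵤ k e⊏yₖ)))

  extend₁ : ∀ {n} {x : Fin n → V.Point} {y} → Gapped V W x y → ∀ e → ⊤ → Σ V.Point λ f → Gapped V W (f ∷ x) (e ∷ y)
  extend₁ {x = x} {y} g e _ with any? (λ i → y i W.ᴾ.≟ e)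
  ... | yes (i , refl) = x i , Gapped-∷ V W g (λ j → g i j , g j i)
  ... | no ∄i = split (greatest V.⊏-isSTO x (λ k → y k W.ᴾ.<? e)) (least V.⊏-isSTO x (λ k → e W.ᴾ.<? y k))
    where
      e∉y : ∀ j → y j ≢ e
      e∉y j yⱼ≡e = ∄i (j , yⱼ≡e)

      split : (∀ k → ¬ y k W.⊏ e) ⊎ ∃[ l ] y l W.⊏ e × (∀ k → y k W.⊏ e → x k V.⊏ x l ⊎ x k ≡ x l) →
              (∀ k → ¬ e W.⊏ y k) ⊎ ∃[ u ] e W.⊏ y u × (∀ k → e W.⊏ y k → x u V.⊏ x k ⊎ x u ≡ x k) →
              Σ V.Point λ f → Gapped V W (f ∷ x) (e ∷ y)
      split (inj₁ ∄l) _ = freshBlock g e e∉y (λ i _ yᵢ⊏e _ → ⊥-elim (∄l i yᵢ⊏e))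
      split _ (inj₁ ∄u) = freshBlock g e e∉y (λ _ j _ yⱼ⋢e → ⊥-elim (∄u j (≢-≮⇒> W.⊏-isSTO (e∉y j) yⱼ⋢e)))
      split (inj₂ (l , yₗ⊏e , maxₗ)) (inj₂ (u , e⊏yᵤ , minᵤ)) with V.block (x l) V.ᴮ.≟ V.block (x u)
      ... | yes bₗ≡bᵤ = inBlock g e e∉y l u yₗ⊏e maxₗ e⊏yᵤ minᵤ bₗ≡bᵤ
      ... | no  bₗ≢bᵤ = freshBlock g e e∉y λ i j yᵢ⊏e yⱼ⋢e →
        ≤-<-trans V.<ᴮ-isSTO (V.block-mono (maxₗ i yᵢ⊏e))
          (<-≤-trans V.<ᴮ-isSTO bₗ<bᵤ (V.block-mono (minᵤ j (≢-≮⇒> W.⊏-isSTO (e∉y j) yⱼ⋢e))))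
        where
          bₗ<bᵤ : V.block (x l) V.<ᴮ V.block (x u)
          bₗ<bᵤ with V.block-mono (inj₁ (Equivalence.from (proj₁ (atomic (g l u))) (W.⊏-trans yₗ⊏e e⊏yᵤ)))
          ... | inj₁ bₗ<bᵤ = bₗ<bᵤ
          ... | inj₂ bₗ≡bᵤ = ⊥-elim (bₗ≢bᵤ bₗ≡bᵤ)

  extend : ∀ m {n} {x : Fin n → V.Point} {y} → Gapped V W x y → (d : Fin m → W.Point) →
           Σ (Fin m → V.Point) λ c → Gapped V W (x ++ c) (y ++ d)
  extend m g d = extendAll (Gapped V W) (Pairwise-reindex {Q = GapAgree V W}) (λ _ → ⊤) extend₁ m g d (λ _ → tt)

-- The levels of the game

strictUpperBound : ∀ m (f : Fin m → ℕ) → Σ ℕ λ b → ∀ k → f k < b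
strictUpperBound zero    f = 0 , λ ()
strictUpperBound (suc m) f =
  let b , f<b = strictUpperBound m (f ∘ suc)
  in suc (f zero + b) ,
     λ { zero → s≤s (ℕ.m≤m+n (f zero) b) ; (suc k) → ℕ.<-trans (f<b k) (s≤s (ℕ.m≤n+m b (f zero))) }

Matching-[] : ∀ {V W R} {x : Fin 0 → BlockOrder.Point V} {y} → Matching V W R x y
Matching-[] = record { samePos = λ () ; sameBlocks = λ () ; sizes = λ () }

Matching-inj₁ : ∀ {V₁ V₂ W R n} {x : Fin n → BlockOrder.Point V₁} {y} → Matching V₁ W R x y →
                Matching (V₁ ⊕ᴮ V₂) W R (inj₁ ∘ x) y
Matching-inj₁ m = record
  { samePos    = samePos m
  ; sameBlocks = λ i j → let <⇔ , ≡⇔ = sameBlocks m i j in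
      ⇔.trans (mk⇔ drop-inj₁ ₁∼₁) <⇔ , ⇔.trans (mk⇔ inj₁-injective (cong inj₁)) ≡⇔
  ; sizes      = sizes m
  }

module Levels (A B : BlockOrder) (A-dense : ∀ s → BlocksDense A (_≡ s))
              (B-dense : ∀ k → BlocksDense B (_≡ just k)) where
  private
    module A = BlockOrder A
    module B = BlockOrder B

  Matching⇒BF₁ : ∀ {R n} {x : Fin n → B.Point} {y} → Matching B A R x y → BF 1 (toLO B) x (toLO A) y
  Matching⇒BF₁ m = Step⇒BF 0 {toLO B} {toLO A} λ k d →
    let c , g = GapMove.extend B A (BlocksDense-weaken B (λ _ → tt) (B-dense 0)) k (Matching⇒Gapped B A m) d
    in c , SameAtomic-sym {toLO B} {toLO A} (Gapped⇒SameAtomic B A g)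

  Matching⇒BF₂ : ∀ {n} {y : Fin n → A.Point} {x} → Matching A B (flip _≤ˢ_) y x → BF 2 (toLO A) y (toLO B) x
  Matching⇒BF₂ m = Step⇒BF 1 {toLO A} {toLO B} λ k d →
    let bound , d<bound = strictUpperBound k (B.pos ∘ d)
        c , m′ = MatchingMove.extend A B (flip _≤ˢ_) (λ s → BlocksDense-weaken A (λ { refl → ≤ˢ-refl s }) (A-dense s))
                   bound (λ t≤s n<t _ → <ˢ-mono n<t t≤s) k m d d<bound
    in c , Matching⇒BF₁ (Matching-sym m′)

  Matching⇒BF₃ : ∀ {n} {x : Fin n → B.Point} {y} → Matching B A _≡_ x y → BF 3 (toLO B) x (toLO A) y
  Matching⇒BF₃ m = Step⇒BF 2 {toLO B} {toLO A} λ k d →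
    let bound , d<bound = strictUpperBound k (A.pos ∘ d)
        c , m′ = MatchingMove.extend B A (Shrinks bound) (dense bound) bound (λ t≲s n<s n<b → proj₂ t≲s n<b n<s) k
                   (Matching-weaken B A (λ { refl → ≤ˢ-refl _ , λ _ n<s → n<s }) m) d d<bound
    in c , Matching⇒BF₂ (Matching-sym (Matching-weaken B A proj₁ m′))
    where
      -- An ω-block of A is answered by a finite block of B that is long enough for the current challenge.
      Shrinks : ℕ → Size → Size → Set
      Shrinks bound t s = t ≤ˢ s × (∀ {n} → n < bound → n <ˢ s → n <ˢ t)

      dense : ∀ bound s → BlocksDense B (λ t → Shrinks bound t s)
      dense bound nothing  = BlocksDense-weaken B (λ { refl → tt , λ n<b _ → ℕ.m<n⇒m<1+n n<b }) (B-dense bound)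
      dense bound (just k) = BlocksDense-weaken B (λ { refl → ℕ.≤-refl , λ _ n<s → n<s }) (B-dense k)

  Matching⇒BF₄ : ∀ {n} {y : Fin n → A.Point} {x} → Matching A B _≡_ y x → BF 4 (toLO A) y (toLO B) x
  Matching⇒BF₄ m = Step⇒BF 3 {toLO A} {toLO B} λ k d →
    let bound , d<bound = strictUpperBound k (B.pos ∘ d)
        c , m′ = MatchingMove.extend A B _≡_ A-dense bound (λ { refl n<t _ → n<t }) k m d d<bound
    in c , Matching⇒BF₃ (Matching-weaken B A sym (Matching-sym m′))

⊕ᴮ-≤₅ : ∀ A₁ B₂ A → (∀ s → BlocksDense A₁ (_≡ s)) → (∀ k → BlocksDense B₂ (_≡ just k)) →
        (∀ s → BlocksDense A (_≡ s)) → toLO (A₁ ⊕ᴮ B₂) ≤[ 5 ] toLO A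
⊕ᴮ-≤₅ A₁ B₂ A A₁-dense B₂-dense A-dense =
  Step⇒BF 4 {toLO (A₁ ⊕ᴮ B₂)} {toLO A} {a = λ ()} {b = λ ()} λ k d →
    let bound , d<bound = strictUpperBound k (BlockOrder.pos A ∘ d)
        c , m = MatchingMove.extend A₁ A _≡_ A₁-dense bound (λ { refl n<t _ → n<t }) k
                  (Matching-[] {x = λ ()} {y = λ ()}) d d<bound
    in inj₁ ∘ c , Matching⇒BF₄ (Matching-weaken A (A₁ ⊕ᴮ B₂) sym (Matching-sym (Matching-inj₁ m)))
  where
    open Levels A (A₁ ⊕ᴮ B₂) A-dense (λ k → ⊕ᴮ-dense {A₁} {B₂} (A₁-dense (just k)) (B₂-dense k))

mainTheorem19 : (D₁ D₃ : ColoredDense (Maybe ℕ)) (D₂ : ColoredDense ℕ) →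
    (Shω+1 D₁ ⊕ Shω D₂) ≤[ 5 ] Shω+1 D₃
mainTheorem19 D₁ D₃ D₂ =
  ⊕ᴮ-≤₅ (shuffleBlocks id D₁) (shuffleBlocks just D₂) (shuffleBlocks id D₃)
        (shuffleBlocks-dense id D₁) (shuffleBlocks-dense just D₂) (shuffleBlocks-dense id D₃)
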